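{- Neither of the PNmatrices $\mathfrak M_{\le}$ and $\mathfrak M_{\mathsf{up}}$ is monadic.
   Context: Let $\mathcal{V}_6=\{\hat{\mathbf f},\mathbf f,\mathbf n,\mathbf b,\mathbf t,\hat{\mathbf t}\}$, partially ordered as a bounded distributive lattice by $\hat{\mathbf f}<\mathbf f<\mathbf n<\mathbf t<\hat{\mathbf t}$ and $\mathbf f<\mathbf b<\mathbf t$, with $\mathbf n,\mathbf b$ incomparable. $\mathbf{PP}_6^{\Rightarrow_H}$ is the algebra on $\mathcal V_6$ in the signature $\{\land,\lor,\Rightarrow,{\sim},\circ,\bot,\top\}$ where $\land,\lor$ are meet and join, $\bot=\hat{\mathbf f}$, $\top=\hat{\mathbf t}$, ${\sim}$ swaps $\mathbf f\leftrightarrow\mathbf t$ and $\hat{\mathbf f}\leftrightarrow\hat{\mathbf t}$ and fixes $\mathbf n,\mathbf b$, ${\circ}a=\hat{\mathbf t}$ if $a\in\{\hat{\mathbf f},\hat{\mathbf t}\}$ and $\hat{\mathbf f}$ otherwise, and $a\Rightarrow b=\max\{c: a\land c\le b\}$. A PNmatrix $\langle\mathbf A,D\rangle$: $\mathbf A$ a multialgebra (connectives interpreted as maps $A^k\to\wp(A)$), $D\subseteq A$. A valuation is a map $h$ from formulas to $A$ with $h(\copyright(\varphi_1,\dots,\varphi_k))\in\copyright^{\mathbf A}(h(\varphi_1),\dots,h(\varphi_k))$. For a formula $S(p)$ in the single variable $p$ and $a\in A$, $S^{\mathbf A}(a)=\{h(S): h$ a valuation with $h(p)=a\}$. The PNmatrix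 is monadic if for every pair of distinct $a,b\in A$ there is a single-variable formula $S$ with ($S^{\mathbf A}(a)\subseteq D$ and $S^{\mathbf A}(b)\subseteq A\setminus D$) or ($S^{\mathbf A}(b)\subseteq D$ and $S^{\mathbf A}(a)\subseteq A\setminus D$). Let $\mathcal V_{10}=\{\hat{\mathbf f},\mathbf f^-,\mathbf n^-,\mathbf b^-,\mathbf t^-,\mathbf f^+,\mathbf n^+,\mathbf b^+,\mathbf t^+,\hat{\mathbf t}\}$, $D=\{\mathbf f^+,\mathbf n^+,\mathbf b^+,\mathbf t^+,\hat{\mathbf t}\}$, and $g\colon\mathcal V_{10}\to\mathcal V_6$ with $g(\hat{\mathbf f})=\hat{\mathbf f}$, $g(\hat{\mathbf t})=\hat{\mathbf t}$, $g(a^{\pm})=a$. For $X\subseteq\mathcal V_{10}$, $\mathsf{inc}_{\mathsf{up}}(X)$ holds iff $X$ includes one of the sets $\{a^-,a^+\}$ ($a\in\{\mathbf f,\mathbf n,\mathbf b,\mathbf t\}$), $\{\mathbf b^-,\mathbf f^+\}$, $\{\mathbf n^-,\mathbf f^+\}$, $\{\mathbf b^+,\mathbf t^-\}$, $\{\mathbf n^+,\mathbf t^-\}$, $\{\mathbf n^+,\mathbf b^+,\mathbf f^-\}$; $\mathsf{inc}_{\le}(X)$ holds iff $X$ includes one of these sets or $\{\mathbf n^-,\mathbf b^-,\mathbf t^+\}$. $\mathfrak M_{\mathsf{up}}=\langle\mathbf A_{\mathsf{up}},D\rangle$ and $\mathfrak M_{\le}=\langle\mathbf A_{\le},D\rangle$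 are PNmatrices on $\mathcal V_{10}$ where, for each $k$-ary connective $\copyright$ and $a_1,\dots,a_k\in\mathcal V_{10}$: $\copyright_{\mathsf{up}}(a_1,\dots,a_k)=\{c: \copyright^{\mathbf{PP}_6^{\Rightarrow_H}}(g(a_1),\dots,g(a_k))=g(c)$ and not $\mathsf{inc}_{\mathsf{up}}(\{a_1,\dots,a_k,c\})\}$, and $\copyright_{\le}$ likewise with $\mathsf{inc}_{\le}$. -}

module Defs where

open import Data.Nat using (ℕ)
open import Data.List using (List; []; _∷_)
open import Data.List.Membership.Propositional using (_∈_)
open import Data.List.Relation.Unary.All using (All)
open import Data.List.Relation.Unary.Any using (Any)
open import Data.Product using (Σ; _×_)
open import Data.Sum using (_⊎_)
open import Data.Unit using (⊤)
open import Relation.Binary.PropositionalEquality using (_≡_; _≢_)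
open import Relation.Nullary using (¬_)

data V6 : Set where
  fh f n b t th : V6        -- fh = \hat f, th = \hat t

data _≤6_ : V6 → V6 → Set where
  ≤-refl : ∀ {x} → x ≤6 x
  fh≤f : fh ≤6 f
  fh≤n : fh ≤6 n
  fh≤b : fh ≤6 b
  fh≤t : fh ≤6 t
  fh≤th : fh ≤6 th
  f≤n : f ≤6 n
  f≤b : f ≤6 b
  f≤t : f ≤6 t
  f≤th : f ≤6 th
  n≤t : n ≤6 t
  n≤th : n ≤6 th
  b≤t : b ≤6 t
  b≤th : b ≤6 th
  t≤th : t ≤6 th

_∧6_ : V6 → V6 → V6
fh ∧6 _  = fh
_  ∧6 fh = fh
th ∧6 y  = y
x  ∧6 th = x
f  ∧6 _  = f
_  ∧6 f  = f
t  ∧6 y  = y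
x  ∧6 t  = x
n  ∧6 n  = n
b  ∧6 b  = b
n  ∧6 b  = f
b  ∧6 n  = f

_∨6_ : V6 → V6 → V6
th ∨6 _  = th
_  ∨6 th = th
fh ∨6 y  = y
x  ∨6 fh = x
t  ∨6 _  = t
_  ∨6 t  = t
f  ∨6 y  = y
x  ∨6 f  = x
n  ∨6 n  = n
b  ∨6 b  = b
n  ∨6 b  = t
b  ∨6 n  = t

∼6 : V6 → V6
∼6 fh = th
∼6 f  = t
∼6 n  = n
∼6 b  = b
∼6 t  = f
∼6 th = fh

∘6 : V6 → V6
∘6 fh = th
∘6 th = th
∘6 _  = fh

-- Heyting implication, literally: c = a ⇒ b iff c = max { d : a ∧ d ≤ b }
IsImp6 : V6 → V6 → V6 → Set
IsImp6 a b' c = ((a ∧6 c) ≤6 b') × (∀ d → (a ∧6 d) ≤6 b' → d ≤6 c)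

data V4 : Set where
  f₄ n₄ b₄ t₄ : V4

data V10 : Set where
  fhat that : V10
  minus plus : V4 → V10     -- minus a = a^- , plus a = a^+

emb : V4 → V6
emb f₄ = f
emb n₄ = n
emb b₄ = b
emb t₄ = t

g : V10 → V6
g fhat = fh
g that = th
g (minus a) = emb a
g (plus a) = emb a

data InD : V10 → Set where
  D-plus : ∀ a → InD (plus a)
  D-that : InD that

-- inclusion predicates (X given as a finite list of elements)

Includes : List V10 → List V10 → Set
Includes X S = All (λ s → s ∈ X) S

forbiddenUp : List (List V10)
forbiddenUp =
  (minus f₄ ∷ plus f₄ ∷ []) ∷
  (minus n₄ ∷ plus n₄ ∷ []) ∷
  (minus b₄ ∷ plus b₄ ∷ []) ∷
  (minus t₄ ∷ plus t₄ ∷ []) ∷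
  (minus b₄ ∷ plus f₄ ∷ []) ∷
  (minus n₄ ∷ plus f₄ ∷ []) ∷
  (plus b₄ ∷ minus t₄ ∷ []) ∷
  (plus n₄ ∷ minus t₄ ∷ []) ∷
  (plus n₄ ∷ plus b₄ ∷ minus f₄ ∷ []) ∷
  []

forbiddenLe : List (List V10)
forbiddenLe = (minus n₄ ∷ minus b₄ ∷ plus t₄ ∷ []) ∷ forbiddenUp

inc-up : List V10 → Set
inc-up X = Any (Includes X) forbiddenUp

inc-le : List V10 → Set
inc-le X = Any (Includes X) forbiddenLe

-- Multialgebras over V10 (multioperations given by their graphs:
-- "c ∈ ©(a₁,…,a_k)")

record MultiAlg : Set₁ where
  field
    and or imp : V10 → V10 → V10 → Set
    neg circ : V10 → V10 → Set
    bot top : V10 → Set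

mkA : (List V10 → Set) → MultiAlg
mkA inc = record
  { and  = λ a₁ a₂ c → (g a₁ ∧6 g a₂ ≡ g c) × ¬ inc (a₁ ∷ a₂ ∷ c ∷ [])
  ; or   = λ a₁ a₂ c → (g a₁ ∨6 g a₂ ≡ g c) × ¬ inc (a₁ ∷ a₂ ∷ c ∷ [])
  ; imp  = λ a₁ a₂ c → IsImp6 (g a₁) (g a₂) (g c) × ¬ inc (a₁ ∷ a₂ ∷ c ∷ [])
  ; neg  = λ a₁ c → (∼6 (g a₁) ≡ g c) × ¬ inc (a₁ ∷ c ∷ [])
  ; circ = λ a₁ c → (∘6 (g a₁) ≡ g c) × ¬ inc (a₁ ∷ c ∷ [])
  ; bot  = λ c → (fh ≡ g c) × ¬ inc (c ∷ [])
  ; top  = λ c → (th ≡ g c) × ¬ inc (c ∷ [])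
  }

A-up : MultiAlg
A-up = mkA inc-up

A-le : MultiAlg
A-le = mkA inc-le

data Fm : Set where
  var : ℕ → Fm
  _∧ᶠ_ _∨ᶠ_ _⇒ᶠ_ : Fm → Fm → Fm
  ∼ᶠ ∘ᶠ : Fm → Fm
  ⊥ᶠ ⊤ᶠ : Fm

-- p is the variable var 0; single-variable formulas use only p
data OneVar : Fm → Set where
  ov-var : OneVar (var 0)
  ov-and : ∀ {φ ψ} → OneVar φ → OneVar ψ → OneVar (φ ∧ᶠ ψ)
  ov-or  : ∀ {φ ψ} → OneVar φ → OneVar ψ → OneVar (φ ∨ᶠ ψ)
  ov-imp : ∀ {φ ψ} → OneVar φ → OneVar ψ → OneVar (φ ⇒ᶠ ψ)
  ov-neg : ∀ {φ} → OneVar φ → OneVar (∼ᶠ φ)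
  ov-circ : ∀ {φ} → OneVar φ → OneVar (∘ᶠ φ)
  ov-bot : OneVar ⊥ᶠ
  ov-top : OneVar ⊤ᶠ

module _ (M : MultiAlg) where
  open MultiAlg M

  LocalOK : (Fm → V10) → Fm → Set
  LocalOK h (var _) = ⊤
  LocalOK h (φ ∧ᶠ ψ) = and (h φ) (h ψ) (h (φ ∧ᶠ ψ))
  LocalOK h (φ ∨ᶠ ψ) = or (h φ) (h ψ) (h (φ ∨ᶠ ψ))
  LocalOK h (φ ⇒ᶠ ψ) = imp (h φ) (h ψ) (h (φ ⇒ᶠ ψ))
  LocalOK h (∼ᶠ φ) = neg (h φ) (h (∼ᶠ φ))
  LocalOK h (∘ᶠ φ) = circ (h φ) (h (∘ᶠ φ))
  LocalOK h ⊥ᶠ = bot (h ⊥ᶠ)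
  LocalOK h ⊤ᶠ = top (h ⊤ᶠ)

  IsValuation : (Fm → V10) → Set
  IsValuation h = ∀ φ → LocalOK h φ

  AllDesignated : Fm → V10 → Set
  AllDesignated S a = ∀ h → IsValuation h → h (var 0) ≡ a → InD (h S)

  AllUndesignated : Fm → V10 → Set
  AllUndesignated S a = ∀ h → IsValuation h → h (var 0) ≡ a → ¬ InD (h S)

  Separates : Fm → V10 → V10 → Set
  Separates S a b' = AllDesignated S a × AllUndesignated S b'

  Monadic : Set
  Monadic = ∀ a b' → a ≢ b' →
    Σ Fm (λ S → OneVar S × (Separates S a b' ⊎ Separates S b' a))

{-# OPTIONS --safe #-}
module Submission where

-- Swapping n and b (in both polarities) is an automorphism of both multialgebras
-- preserving D. Since {f̂, n⁺, t̂} is a subalgebra of PP6 containing no forbidden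
-- set, some valuation has p ↦ n⁺; composed with the swap it becomes one with
-- p ↦ b⁺ and the same designation on every formula, so no single-variable
-- formula separates n⁺ from b⁺.

open import Defs
open import Data.Empty using (⊥)
open import Data.List using (List; []; _∷_; map)
open import Data.List.Membership.Propositional using (_∈_)
open import Data.List.Membership.Propositional.Properties using (∈-map⁻)
open import Data.List.Relation.Unary.All using (All; []; _∷_; lookupWith)
open import Data.List.Relation.Unary.Any using (Any; here; there)
open import Data.Product as Product using (_×_; _,_)
open import Data.Sum using (inj₁; inj₂)
open import Data.Unit using (⊤; tt)
open import Function using (_∘_; _⇔_; mk⇔; Equivalence)
open import Relation.Binary.PropositionalEquality
open import Relation.Nullary using (¬_; contraposition)

∀-V6 : {P : V6 → Set} → P fh → P f → P n → P b → P t → P th → ∀ x → P x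
∀-V6 p _ _ _ _ _ fh = p
∀-V6 _ p _ _ _ _ f  = p
∀-V6 _ _ p _ _ _ n  = p
∀-V6 _ _ _ p _ _ b  = p
∀-V6 _ _ _ _ p _ t  = p
∀-V6 _ _ _ _ _ p th = p

swapNB₆ : V6 → V6
swapNB₆ n = b
swapNB₆ b = n
swapNB₆ x = x

swapNB₆-involutive : ∀ x → swapNB₆ (swapNB₆ x) ≡ x
swapNB₆-involutive = ∀-V6 refl refl refl refl refl refl

swapNB₆-∧-homo : ∀ x y → swapNB₆ (x ∧6 y) ≡ swapNB₆ x ∧6 swapNB₆ y
swapNB₆-∧-homo = ∀-V6
  (∀-V6 refl refl refl refl refl refl) (∀-V6 refl refl refl refl refl refl)
  (∀-V6 refl refl refl refl refl refl) (∀-V6 refl refl refl refl refl refl)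
  (∀-V6 refl refl refl refl refl refl) (∀-V6 refl refl refl refl refl refl)

swapNB₆-∨-homo : ∀ x y → swapNB₆ (x ∨6 y) ≡ swapNB₆ x ∨6 swapNB₆ y
swapNB₆-∨-homo = ∀-V6
  (∀-V6 refl refl refl refl refl refl) (∀-V6 refl refl refl refl refl refl)
  (∀-V6 refl refl refl refl refl refl) (∀-V6 refl refl refl refl refl refl)
  (∀-V6 refl refl refl refl refl refl) (∀-V6 refl refl refl refl refl refl)

swapNB₆-∼-homo : ∀ x → swapNB₆ (∼6 x) ≡ ∼6 (swapNB₆ x)
swapNB₆-∼-homo = ∀-V6 refl refl refl refl refl refl

swapNB₆-∘-homo : ∀ x → swapNB₆ (∘6 x) ≡ ∘6 (swapNB₆ x)
swapNB₆-∘-homo = ∀-V6 refl refl refl refl refl refl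

swapNB₆-mono-≤ : ∀ {x y} → x ≤6 y → swapNB₆ x ≤6 swapNB₆ y
swapNB₆-mono-≤ ≤-refl = ≤-refl
swapNB₆-mono-≤ fh≤f   = fh≤f
swapNB₆-mono-≤ fh≤n   = fh≤b
swapNB₆-mono-≤ fh≤b   = fh≤n
swapNB₆-mono-≤ fh≤t   = fh≤t
swapNB₆-mono-≤ fh≤th  = fh≤th
swapNB₆-mono-≤ f≤n    = f≤b
swapNB₆-mono-≤ f≤b    = f≤n
swapNB₆-mono-≤ f≤t    = f≤t
swapNB₆-mono-≤ f≤th   = f≤th
swapNB₆-mono-≤ n≤t    = b≤t
swapNB₆-mono-≤ n≤th   = b≤th
swapNB₆-mono-≤ b≤t    = n≤t
swapNB₆-mono-≤ b≤th   = n≤th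
swapNB₆-mono-≤ t≤th   = t≤th

swapNB₆-IsImp6 : ∀ x y c → IsImp6 x y c → IsImp6 (swapNB₆ x) (swapNB₆ y) (swapNB₆ c)
swapNB₆-IsImp6 x y c (x∧c≤y , maximal) = x∧c≤y′ , maximal′
  where
  x∧c≤y′ : (swapNB₆ x ∧6 swapNB₆ c) ≤6 swapNB₆ y
  x∧c≤y′ = subst (_≤6 swapNB₆ y) (swapNB₆-∧-homo x c) (swapNB₆-mono-≤ x∧c≤y)

  maximal′ : ∀ d → (swapNB₆ x ∧6 d) ≤6 swapNB₆ y → d ≤6 swapNB₆ c
  maximal′ d x∧d≤y =
    subst (_≤6 swapNB₆ c) (swapNB₆-involutive d)
      (swapNB₆-mono-≤ (maximal (swapNB₆ d) x∧swapd≤y))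
    where
    x∧swapd : swapNB₆ (swapNB₆ x ∧6 d) ≡ x ∧6 swapNB₆ d
    x∧swapd = trans (swapNB₆-∧-homo (swapNB₆ x) d)
                    (cong (_∧6 swapNB₆ d) (swapNB₆-involutive x))

    x∧swapd≤y : (x ∧6 swapNB₆ d) ≤6 y
    x∧swapd≤y = subst₂ _≤6_ x∧swapd (swapNB₆-involutive y) (swapNB₆-mono-≤ x∧d≤y)

swapNB₄ : V4 → V4
swapNB₄ n₄ = b₄
swapNB₄ b₄ = n₄
swapNB₄ a  = a

swapNB : V10 → V10
swapNB (minus a) = minus (swapNB₄ a)
swapNB (plus a)  = plus (swapNB₄ a)
swapNB x         = x

swapNB₄-involutive : ∀ a → swapNB₄ (swapNB₄ a) ≡ a
swapNB₄-involutive f₄ = refl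
swapNB₄-involutive n₄ = refl
swapNB₄-involutive b₄ = refl
swapNB₄-involutive t₄ = refl

swapNB-involutive : ∀ x → swapNB (swapNB x) ≡ x
swapNB-involutive fhat      = refl
swapNB-involutive that      = refl
swapNB-involutive (minus a) = cong minus (swapNB₄-involutive a)
swapNB-involutive (plus a)  = cong plus (swapNB₄-involutive a)

emb-swapNB₄ : ∀ a → emb (swapNB₄ a) ≡ swapNB₆ (emb a)
emb-swapNB₄ f₄ = refl
emb-swapNB₄ n₄ = refl
emb-swapNB₄ b₄ = refl
emb-swapNB₄ t₄ = refl

g-swapNB : ∀ x → g (swapNB x) ≡ swapNB₆ (g x)
g-swapNB fhat      = refl
g-swapNB that      = refl
g-swapNB (minus a) = emb-swapNB₄ a
g-swapNB (plus a)  = emb-swapNB₄ a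

InD-swapNB : ∀ {x} → InD x → InD (swapNB x)
InD-swapNB (D-plus a) = D-plus (swapNB₄ a)
InD-swapNB D-that     = D-that

InD-swapNB⇔ : ∀ x → InD x ⇔ InD (swapNB x)
InD-swapNB⇔ x = mk⇔ InD-swapNB (subst InD (swapNB-involutive x) ∘ InD-swapNB)

∈-map-swapNB : ∀ {s X} → s ∈ map swapNB X → swapNB s ∈ X
∈-map-swapNB p with ∈-map⁻ swapNB p
... | x , x∈X , refl = subst (_∈ _) (sym (swapNB-involutive x)) x∈X

inc-up-swapNB : ∀ X → inc-up (map swapNB X) → inc-up X
inc-up-swapNB X = reindex
  where
  unswap : ∀ {s} → s ∈ map swapNB X → swapNB s ∈ X
  unswap = ∈-map-swapNB

  -- the swap permutes forbiddenUp: entries 1 ↔ 2, 4 ↔ 5, 6 ↔ 7 (counting from 0),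
  -- and entry 8 up to reordering
  reindex : inc-up (map swapNB X) → inc-up X
  reindex (here (p ∷ q ∷ [])) = here (unswap p ∷ unswap q ∷ [])
  reindex (there (here (p ∷ q ∷ []))) = there (there (here (unswap p ∷ unswap q ∷ [])))
  reindex (there (there (here (p ∷ q ∷ [])))) = there (here (unswap p ∷ unswap q ∷ []))
  reindex (there (there (there (here (p ∷ q ∷ []))))) =
    there (there (there (here (unswap p ∷ unswap q ∷ []))))
  reindex (there (there (there (there (here (p ∷ q ∷ [])))))) =
    there (there (there (there (there (here (unswap p ∷ unswap q ∷ []))))))
  reindex (there (there (there (there (there (here (p ∷ q ∷ []))))))) =
    there (there (there (there (here (unswap p ∷ unswap q ∷ [])))))
  reindex (there (there (there (there (there (there (here (p ∷ q ∷ [])))))))) =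
    there (there (there (there (there (there (there (here (unswap p ∷ unswap q ∷ []))))))))
  reindex (there (there (there (there (there (there (there (here (p ∷ q ∷ []))))))))) =
    there (there (there (there (there (there (here (unswap p ∷ unswap q ∷ [])))))))
  reindex (there (there (there (there (there (there (there (there (here (p ∷ q ∷ r ∷ [])))))))))) =
    there (there (there (there (there (there (there (there (here (unswap q ∷ unswap p ∷ unswap r ∷ [])))))))))

inc-le-swapNB : ∀ X → inc-le (map swapNB X) → inc-le X
inc-le-swapNB X (here (p ∷ q ∷ r ∷ [])) =
  here (∈-map-swapNB q ∷ ∈-map-swapNB p ∷ ∈-map-swapNB r ∷ [])
inc-le-swapNB X (there i) = there (inc-up-swapNB X i)

module _ (op : V6 → V6 → V6) (homo : ∀ x y → swapNB₆ (op x y) ≡ op (swapNB₆ x) (swapNB₆ y)) where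
  open ≡-Reasoning

  swapNB-lifts₂ : ∀ a₁ a₂ c → op (g a₁) (g a₂) ≡ g c →
                  op (g (swapNB a₁)) (g (swapNB a₂)) ≡ g (swapNB c)
  swapNB-lifts₂ a₁ a₂ c eq = begin
    op (g (swapNB a₁)) (g (swapNB a₂))   ≡⟨ cong₂ op (g-swapNB a₁) (g-swapNB a₂) ⟩
    op (swapNB₆ (g a₁)) (swapNB₆ (g a₂)) ≡⟨ homo (g a₁) (g a₂) ⟨
    swapNB₆ (op (g a₁) (g a₂))           ≡⟨ cong swapNB₆ eq ⟩
    swapNB₆ (g c)                        ≡⟨ g-swapNB c ⟨
    g (swapNB c)                         ∎

module _ (op : V6 → V6) (homo : ∀ x → swapNB₆ (op x) ≡ op (swapNB₆ x)) where
  open ≡-Reasoning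

  swapNB-lifts₁ : ∀ a c → op (g a) ≡ g c → op (g (swapNB a)) ≡ g (swapNB c)
  swapNB-lifts₁ a c eq = begin
    op (g (swapNB a))   ≡⟨ cong op (g-swapNB a) ⟩
    op (swapNB₆ (g a))  ≡⟨ homo (g a) ⟨
    swapNB₆ (op (g a))  ≡⟨ cong swapNB₆ eq ⟩
    swapNB₆ (g c)       ≡⟨ g-swapNB c ⟨
    g (swapNB c)        ∎

swapNB-lifts₀ : ∀ {x} c → swapNB₆ x ≡ x → x ≡ g c → x ≡ g (swapNB c)
swapNB-lifts₀ c fixed eq = trans (sym fixed) (trans (cong swapNB₆ eq) (sym (g-swapNB c)))

swapNB-IsImp6 : ∀ a₁ a₂ c → IsImp6 (g a₁) (g a₂) (g c) →
                IsImp6 (g (swapNB a₁)) (g (swapNB a₂)) (g (swapNB c))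
swapNB-IsImp6 a₁ a₂ c imp
  rewrite g-swapNB a₁ | g-swapNB a₂ | g-swapNB c = swapNB₆-IsImp6 (g a₁) (g a₂) (g c) imp

module _ {inc : List V10 → Set} (inc-swapNB : ∀ X → inc (map swapNB X) → inc X) where
  private
    M = mkA inc

    ¬inc-swapNB : ∀ {X} → ¬ inc X → ¬ inc (map swapNB X)
    ¬inc-swapNB = contraposition (inc-swapNB _)

  swapNB-isValuation : ∀ {k} → IsValuation M k → IsValuation M (swapNB ∘ k)
  swapNB-isValuation         v (var _)  = tt
  swapNB-isValuation {k = k} v (φ ∧ᶠ ψ) =
    Product.map (swapNB-lifts₂ _∧6_ swapNB₆-∧-homo (k φ) (k ψ) (k (φ ∧ᶠ ψ))) ¬inc-swapNB (v (φ ∧ᶠ ψ))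
  swapNB-isValuation {k = k} v (φ ∨ᶠ ψ) =
    Product.map (swapNB-lifts₂ _∨6_ swapNB₆-∨-homo (k φ) (k ψ) (k (φ ∨ᶠ ψ))) ¬inc-swapNB (v (φ ∨ᶠ ψ))
  swapNB-isValuation {k = k} v (φ ⇒ᶠ ψ) =
    Product.map (swapNB-IsImp6 (k φ) (k ψ) (k (φ ⇒ᶠ ψ))) ¬inc-swapNB (v (φ ⇒ᶠ ψ))
  swapNB-isValuation {k = k} v (∼ᶠ φ)   =
    Product.map (swapNB-lifts₁ ∼6 swapNB₆-∼-homo (k φ) (k (∼ᶠ φ))) ¬inc-swapNB (v (∼ᶠ φ))
  swapNB-isValuation {k = k} v (∘ᶠ φ)   =
    Product.map (swapNB-lifts₁ ∘6 swapNB₆-∘-homo (k φ) (k (∘ᶠ φ))) ¬inc-swapNB (v (∘ᶠ φ))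
  swapNB-isValuation {k = k} v ⊥ᶠ       = Product.map (swapNB-lifts₀ (k ⊥ᶠ) refl) ¬inc-swapNB (v ⊥ᶠ)
  swapNB-isValuation {k = k} v ⊤ᶠ       = Product.map (swapNB-lifts₀ (k ⊤ᶠ) refl) ¬inc-swapNB (v ⊤ᶠ)

data Three : Set where
  bot₃ n₃ top₃ : Three

embed : Three → V10
embed bot₃ = fhat
embed n₃   = plus n₄
embed top₃ = that

_∧₃_ _∨₃_ _⇒₃_ : Three → Three → Three
bot₃ ∧₃ _    = bot₃
n₃   ∧₃ bot₃ = bot₃
n₃   ∧₃ _    = n₃
top₃ ∧₃ y    = y

bot₃ ∨₃ y    = y
n₃   ∨₃ top₃ = top₃
n₃   ∨₃ _    = n₃
top₃ ∨₃ _    = top₃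

bot₃ ⇒₃ _    = top₃
n₃   ⇒₃ bot₃ = bot₃
n₃   ⇒₃ _    = top₃
top₃ ⇒₃ y    = y

∼₃ ∘₃ : Three → Three
∼₃ bot₃ = top₃
∼₃ n₃   = n₃
∼₃ top₃ = bot₃

∘₃ n₃ = bot₃
∘₃ _  = top₃

∧₃-sound : ∀ x y → g (embed x) ∧6 g (embed y) ≡ g (embed (x ∧₃ y))
∧₃-sound bot₃ _    = refl
∧₃-sound n₃   bot₃ = refl
∧₃-sound n₃   n₃   = refl
∧₃-sound n₃   top₃ = refl
∧₃-sound top₃ bot₃ = refl
∧₃-sound top₃ n₃   = refl
∧₃-sound top₃ top₃ = refl

∨₃-sound : ∀ x y → g (embed x) ∨6 g (embed y) ≡ g (embed (x ∨₃ y))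
∨₃-sound bot₃ bot₃ = refl
∨₃-sound bot₃ n₃   = refl
∨₃-sound bot₃ top₃ = refl
∨₃-sound n₃   bot₃ = refl
∨₃-sound n₃   n₃   = refl
∨₃-sound n₃   top₃ = refl
∨₃-sound top₃ _    = refl

∼₃-sound : ∀ x → ∼6 (g (embed x)) ≡ g (embed (∼₃ x))
∼₃-sound bot₃ = refl
∼₃-sound n₃   = refl
∼₃-sound top₃ = refl

∘₃-sound : ∀ x → ∘6 (g (embed x)) ≡ g (embed (∘₃ x))
∘₃-sound bot₃ = refl
∘₃-sound n₃   = refl
∘₃-sound top₃ = refl

x≤6th : ∀ x → x ≤6 th
x≤6th = ∀-V6 fh≤th f≤th n≤th b≤th t≤th ≤-refl

th∧6x≡x : ∀ x → th ∧6 x ≡ x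
th∧6x≡x = ∀-V6 refl refl refl refl refl refl

IsImp6-th : ∀ x {y} → (x ∧6 th) ≤6 y → IsImp6 x y th
IsImp6-th _ x≤y = x≤y , λ d _ → x≤6th d

IsImp6-th-left : ∀ y → IsImp6 th y y
IsImp6-th-left y = subst (_≤6 y) (sym (th∧6x≡x y)) ≤-refl , λ d → subst (_≤6 y) (th∧6x≡x d)

⇒₃-sound : ∀ x y → IsImp6 (g (embed x)) (g (embed y)) (g (embed (x ⇒₃ y)))
⇒₃-sound bot₃ bot₃ = IsImp6-th fh ≤-refl
⇒₃-sound bot₃ n₃   = IsImp6-th fh fh≤n
⇒₃-sound bot₃ top₃ = IsImp6-th fh fh≤th
⇒₃-sound n₃   bot₃ = ≤-refl , n∧d≤fh⇒d≤fh
  where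
  n∧d≤fh⇒d≤fh : ∀ d → (n ∧6 d) ≤6 fh → d ≤6 fh
  n∧d≤fh⇒d≤fh fh _ = ≤-refl
  n∧d≤fh⇒d≤fh f  ()
  n∧d≤fh⇒d≤fh n  ()
  n∧d≤fh⇒d≤fh b  ()
  n∧d≤fh⇒d≤fh t  ()
  n∧d≤fh⇒d≤fh th ()
⇒₃-sound n₃   n₃   = IsImp6-th n ≤-refl
⇒₃-sound n₃   top₃ = IsImp6-th n n≤th
⇒₃-sound top₃ y    = IsImp6-th-left (g (embed y))

⟦_⟧₃ : Fm → Three
⟦ var _ ⟧₃  = n₃
⟦ φ ∧ᶠ ψ ⟧₃ = ⟦ φ ⟧₃ ∧₃ ⟦ ψ ⟧₃
⟦ φ ∨ᶠ ψ ⟧₃ = ⟦ φ ⟧₃ ∨₃ ⟦ ψ ⟧₃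
⟦ φ ⇒ᶠ ψ ⟧₃ = ⟦ φ ⟧₃ ⇒₃ ⟦ ψ ⟧₃
⟦ ∼ᶠ φ ⟧₃   = ∼₃ ⟦ φ ⟧₃
⟦ ∘ᶠ φ ⟧₃   = ∘₃ ⟦ φ ⟧₃
⟦ ⊥ᶠ ⟧₃     = bot₃
⟦ ⊤ᶠ ⟧₃     = top₃

OutsideThree : V10 → Set
OutsideThree (minus _)  = ⊤
OutsideThree (plus n₄)  = ⊥
OutsideThree (plus _)   = ⊤
OutsideThree _          = ⊥

∉-map-embed : ∀ {s} xs → OutsideThree s → ¬ s ∈ map embed xs
∉-map-embed (bot₃ ∷ _)  () (here refl)
∉-map-embed (n₃ ∷ _)    () (here refl)
∉-map-embed (top₃ ∷ _)  () (here refl)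
∉-map-embed (_ ∷ xs)    o  (there s∈) = ∉-map-embed xs o s∈

forbiddenLe-leave-Three : All (Any OutsideThree) forbiddenLe
forbiddenLe-leave-Three =
  here tt ∷ here tt ∷ here tt ∷ here tt ∷ here tt ∷ here tt ∷ here tt ∷ here tt ∷
  there (here tt) ∷ there (here tt) ∷ []

¬inc-le-map-embed : ∀ xs → ¬ inc-le (map embed xs)
¬inc-le-map-embed xs = lookupWith leaves forbiddenLe-leave-Three
  where
  leaves : ∀ {S} → Any OutsideThree S → Includes (map embed xs) S → ⊥
  leaves out S⊆ = lookupWith (λ s∈ o → ∉-map-embed xs o s∈) S⊆ out

¬inc-up-map-embed : ∀ xs → ¬ inc-up (map embed xs)
¬inc-up-map-embed xs = ¬inc-le-map-embed xs ∘ there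

module _ (inc : List V10 → Set) (¬inc-map-embed : ∀ xs → ¬ inc (map embed xs)) where

  embed-isValuation : IsValuation (mkA inc) (embed ∘ ⟦_⟧₃)
  embed-isValuation (var _)  = tt
  embed-isValuation (φ ∧ᶠ ψ) = ∧₃-sound ⟦ φ ⟧₃ ⟦ ψ ⟧₃ , ¬inc-map-embed (⟦ φ ⟧₃ ∷ ⟦ ψ ⟧₃ ∷ ⟦ φ ∧ᶠ ψ ⟧₃ ∷ [])
  embed-isValuation (φ ∨ᶠ ψ) = ∨₃-sound ⟦ φ ⟧₃ ⟦ ψ ⟧₃ , ¬inc-map-embed (⟦ φ ⟧₃ ∷ ⟦ ψ ⟧₃ ∷ ⟦ φ ∨ᶠ ψ ⟧₃ ∷ [])
  embed-isValuation (φ ⇒ᶠ ψ) = ⇒₃-sound ⟦ φ ⟧₃ ⟦ ψ ⟧₃ , ¬inc-map-embed (⟦ φ ⟧₃ ∷ ⟦ ψ ⟧₃ ∷ ⟦ φ ⇒ᶠ ψ ⟧₃ ∷ [])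
  embed-isValuation (∼ᶠ φ)   = ∼₃-sound ⟦ φ ⟧₃ , ¬inc-map-embed (⟦ φ ⟧₃ ∷ ⟦ ∼ᶠ φ ⟧₃ ∷ [])
  embed-isValuation (∘ᶠ φ)   = ∘₃-sound ⟦ φ ⟧₃ , ¬inc-map-embed (⟦ φ ⟧₃ ∷ ⟦ ∘ᶠ φ ⟧₃ ∷ [])
  embed-isValuation ⊥ᶠ       = refl , ¬inc-map-embed (bot₃ ∷ [])
  embed-isValuation ⊤ᶠ       = refl , ¬inc-map-embed (top₃ ∷ [])

indiscernible⇒¬Monadic : ∀ M {k₁ k₂} → IsValuation M k₁ → IsValuation M k₂ →
  k₁ (var 0) ≢ k₂ (var 0) → (∀ φ → InD (k₁ φ) ⇔ InD (k₂ φ)) → ¬ Monadic M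
indiscernible⇒¬Monadic M {k₁} {k₂} v₁ v₂ k₁≢k₂ same mon
  with mon (k₁ (var 0)) (k₂ (var 0)) k₁≢k₂
... | S , _ , inj₁ (S⊆D , S∩D≡∅) = S∩D≡∅ k₂ v₂ refl (Equivalence.to (same S) (S⊆D k₁ v₁ refl))
... | S , _ , inj₂ (S⊆D , S∩D≡∅) = S∩D≡∅ k₁ v₁ refl (Equivalence.from (same S) (S⊆D k₂ v₂ refl))

¬Monadic-mkA : ∀ {inc} → (∀ X → inc (map swapNB X) → inc X) → (∀ xs → ¬ inc (map embed xs)) →
  ¬ Monadic (mkA inc)
¬Monadic-mkA {inc} inc-swapNB ¬inc-map-embed =
  indiscernible⇒¬Monadic (mkA inc) n⁺-valuation (swapNB-isValuation inc-swapNB n⁺-valuation)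
    (λ ()) (InD-swapNB⇔ ∘ embed ∘ ⟦_⟧₃)
  where
  n⁺-valuation : IsValuation (mkA inc) (embed ∘ ⟦_⟧₃)
  n⁺-valuation = embed-isValuation inc ¬inc-map-embed

proposition6p1 : ¬ Monadic A-le × ¬ Monadic A-up
proposition6p1 = ¬Monadic-mkA inc-le-swapNB ¬inc-le-map-embed , ¬Monadic-mkA inc-up-swapNB ¬inc-up-map-embed
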